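{- For all integers $m\geq 1$ and $n\geq 1$, the graph $m\Gamma(\mathbb{Z}_6)+n\Gamma(\mathbb{Z}_9)$ (the join of $m\Gamma(\mathbb{Z}_6)$ and $n\Gamma(\mathbb{Z}_9)$) does not admit a distance antimagic labeling.
   Context: For an integer $n \geq 2$, the zero-divisor graph $\Gamma(\mathbb{Z}_n)$ is the simple graph whose vertex set is the set of nonzero zero-divisors of the ring $\mathbb{Z}_n$, two distinct vertices $u,v$ being adjacent iff $uv \equiv 0 \pmod n$. For a graph $H$ and positive integer $k$, $kH$ denotes the disjoint union of $k$ copies of $H$. For graphs $G,H$, the join $G+H$ is the graph obtained from the disjoint union of $G$ and $H$ by adding every edge between a vertex of $G$ and a vertex of $H$. A distance antimagic labeling (DAML) of a graph $G$ with $N$ vertices is a bijection $f:V(G)\to\{1,\dots,N\}$ such that the weights $w(v)=\sum_{u\in N(v)} f(u)$, where $N(v)$ is the open neighbourhood of $v$, are pairwise distinct over all vertices $v$. A graph admits DAML if such a labeling exists. -}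

module Defs where

open import Data.Nat using (ℕ; zero; suc; _+_; _*_; _%_; _≡ᵇ_; NonZero)
open import Data.Bool using (Bool; true; false; _∧_; not; if_then_else_)
open import Data.Fin using (Fin; toℕ; splitAt; _↑ˡ_; _↑ʳ_)
open import Data.Fin.Properties using ()
open import Data.Sum using (inj₁; inj₂)
open import Data.List using (List; filter; length; lookup; allFin; upTo; foldr; map)
open import Data.Bool.ListAction using (any)
open import Data.Product using (Σ; _×_; _,_)
open import Relation.Nullary.Decidable using (Dec; yes; no)
open import Relation.Unary using (Pred)
open import Function.Definitions using (Bijective; Injective)
open import Relation.Binary.PropositionalEquality using (_≡_)

-- A finite simple graph on vertex set Fin N, adjacency given by a Boolean
-- (decidable) relation. (Symmetry / irreflexivity are properties of the
-- concrete graphs constructed below; they are not needed for the notions used.)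
record Graph : Set where
  field
    N   : ℕ
    adj : Fin N → Fin N → Bool
open Graph public

module _ (n : ℕ) .{{_ : NonZero n}} where
  isNZZD : ℕ → Bool
  isNZZD x = not (x ≡ᵇ 0) ∧ any (λ y → not (y ≡ᵇ 0) ∧ ((x * y) % n ≡ᵇ 0)) (upTo n)

  zdList : List ℕ
  zdList = filter (λ x → Data.Bool.T? (isNZZD x)) (upTo n)

  Γℤ : Graph
  Γℤ = record
    { N   = length zdList
    ; adj = λ i j → let a = lookup zdList i ; b = lookup zdList j in
                    not (a ≡ᵇ b) ∧ ((a * b) % n ≡ᵇ 0)
    }

_⊕_ : Graph → Graph → Graph
G ⊕ H = record
  { N   = N G + N H
  ; adj = λ i j → go (splitAt (N G) i) (splitAt (N G) j)
  }
  where
  go : _ → _ → Bool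
  go (inj₁ a) (inj₁ b) = adj G a b
  go (inj₂ a) (inj₂ b) = adj H a b
  go _ _ = false

join : Graph → Graph → Graph
join G H = record
  { N   = N G + N H
  ; adj = λ i j → go (splitAt (N G) i) (splitAt (N G) j)
  }
  where
  go : _ → _ → Bool
  go (inj₁ a) (inj₁ b) = adj G a b
  go (inj₂ a) (inj₂ b) = adj H a b
  go _ _ = true

emptyGraph : Graph
emptyGraph = record { N = 0 ; adj = λ () }

copies : ℕ → Graph → Graph
copies zero    H = emptyGraph
copies (suc k) H = H ⊕ copies k H

-- weight of v under labeling f (label of u is toℕ (f u) + 1 ∈ {1,…,N})
weight : (G : Graph) → (Fin (N G) → Fin (N G)) → Fin (N G) → ℕ
weight G f v = foldr _+_ 0
  (map (λ u → if adj G v u then suc (toℕ (f u)) else 0) (allFin (N G)))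

IsDAML : (G : Graph) → (Fin (N G) → Fin (N G)) → Set
IsDAML G f = Bijective _≡_ _≡_ f × Injective _≡_ _≡_ (weight G f)

AdmitsDAML : Graph → Set
AdmitsDAML G = Σ (Fin (N G) → Fin (N G)) (IsDAML G)

-- Two distinct vertices with the same open neighbourhood ("twins") receive the
-- same weight under every labeling, so a graph with twins admits no DAML.
-- In Γ(ℤ₆) the vertices 2 and 4 are twins (both have neighbourhood {3}), and
-- twins of a component stay twins in a disjoint union and in a join.
module Submission where

open import Defs
open import Data.Nat using (ℕ; _≥_; suc; _+_)
open import Data.Fin using (Fin; zero; suc; toℕ; splitAt; _↑ˡ_)
open import Data.Fin.Properties using (splitAt-↑ˡ; ↑ˡ-injective)
open import Data.List using (foldr; map; allFin)
open import Data.List.Properties using (map-cong)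
open import Data.Bool using (if_then_else_)
open import Data.Sum using (inj₁; inj₂)
open import Data.Product using (_,_)
open import Relation.Nullary using (¬_)
open import Relation.Binary.PropositionalEquality using (_≡_; _≢_; refl; cong)

record Twins (G : Graph) : Set where
  field
    left right : Fin (N G)
    distinct   : left ≢ right
    same-nbhd  : ∀ u → adj G left u ≡ adj G right u

weight-cong : (G : Graph) (f : Fin (N G) → Fin (N G)) {v w : Fin (N G)} →
              (∀ u → adj G v u ≡ adj G w u) → weight G f v ≡ weight G f w
weight-cong G f same =
  cong (foldr _+_ 0)
    (map-cong (λ u → cong (λ b → if b then suc (toℕ (f u)) else 0) (same u))
              (allFin (N G)))

twins⇒¬AdmitsDAML : {G : Graph} → Twins G → ¬ AdmitsDAML G
twins⇒¬AdmitsDAML {G} t (f , _ , weight-injective) =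
  distinct (weight-injective (weight-cong G f same-nbhd))
  where open Twins t

twins-Γℤ6 : Twins (Γℤ 6)
twins-Γℤ6 = record
  { left = zero ; right = suc (suc zero) ; distinct = λ () ; same-nbhd = same }
  where
  same : ∀ u → adj (Γℤ 6) zero u ≡ adj (Γℤ 6) (suc (suc zero)) u
  same zero             = refl
  same (suc zero)       = refl
  same (suc (suc zero)) = refl

module _ {G : Graph} (H : Graph) (t : Twins G) where
  open Twins t

  twins-⊕ˡ : Twins (G ⊕ H)
  twins-⊕ˡ = record
    { left = left ↑ˡ N H
    ; right = right ↑ˡ N H
    ; distinct = λ eq → distinct (↑ˡ-injective (N H) left right eq)
    ; same-nbhd = same
    }
    where
    same : ∀ u → adj (G ⊕ H) (left ↑ˡ N H) u ≡ adj (G ⊕ H) (right ↑ˡ N H) u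
    same u rewrite splitAt-↑ˡ (N G) left (N H) | splitAt-↑ˡ (N G) right (N H)
      with splitAt (N G) u
    ... | inj₁ a = same-nbhd a
    ... | inj₂ _ = refl

  twins-joinˡ : Twins (join G H)
  twins-joinˡ = record
    { left = left ↑ˡ N H
    ; right = right ↑ˡ N H
    ; distinct = λ eq → distinct (↑ˡ-injective (N H) left right eq)
    ; same-nbhd = same
    }
    where
    same : ∀ u → adj (join G H) (left ↑ˡ N H) u ≡ adj (join G H) (right ↑ˡ N H) u
    same u rewrite splitAt-↑ˡ (N G) left (N H) | splitAt-↑ˡ (N G) right (N H)
      with splitAt (N G) u
    ... | inj₁ a = same-nbhd a
    ... | inj₂ _ = refl

theorem2p6 : (m n : ℕ) → m ≥ 1 → n ≥ 1 →
    ¬ AdmitsDAML (join (copies m (Γℤ 6)) (copies n (Γℤ 9)))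
theorem2p6 (suc k) n _ _ =
  twins⇒¬AdmitsDAML
    (twins-joinˡ (copies n (Γℤ 9)) (twins-⊕ˡ (copies k (Γℤ 6)) twins-Γℤ6))
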